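{- Let $F=\{f_i(x)=a_ix+b_i \mid i=1,\ldots,n\}$ with integers $a_i>1$ and $b_i\ge0$, and suppose $F$ provides a system of exact covering congruences, i.e. the sets $f_1(\mathbb Z),\ldots,f_n(\mathbb Z)$ are pairwise disjoint and $f_1(\mathbb Z)\cup\cdots\cup f_n(\mathbb Z)=\mathbb Z$. Then for any integer $s\ge0$ the orbit set $\langle F:s\rangle$ has positive (lower asymptotic) density, i.e. \[ \liminf_{x\to\infty}\frac{1}{x}\bigl|\langle F:s\rangle\cap[0,x]\bigr|>0. \]
   Context: The orbit set $\langle F:s\rangle$ is the smallest set containing $s$ and closed under all $f_i\in F$, i.e. the set of all values $f_{i_1}\circ\cdots\circ f_{i_r}(s)$ for $r\ge0$ and $i_1,\ldots,i_r\in\{1,\ldots,n\}$. -}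

module Defs where

open import Data.Nat using (ℕ; _≤_; _*_)
open import Data.Integer as ℤ using (ℤ; +_; +0) renaming (_+_ to _+ℤ_; _*_ to _*ℤ_; _≤_ to _≤ℤ_; _<_ to _<ℤ_)
open import Data.Fin using (Fin)
open import Data.Product using (Σ; ∃; _×_; _,_)
open import Data.List using (List; length)
open import Data.List.Relation.Unary.All using (All)
open import Data.List.Relation.Unary.Unique.Propositional using (Unique)
open import Relation.Binary.PropositionalEquality using (_≡_; _≢_)

aff : ∀ {n} → (Fin n → ℤ) → (Fin n → ℤ) → Fin n → ℤ → ℤ
aff a b i x = a i *ℤ x +ℤ b i

ExactCover : ∀ {n} → (Fin n → ℤ) → (Fin n → ℤ) → Set
ExactCover {n} a b =
  (∀ (i j : Fin n) (x y : ℤ) → i ≢ j → aff a b i x ≢ aff a b j y)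
  × (∀ (z : ℤ) → Σ (Fin n) λ i → Σ ℤ λ x → aff a b i x ≡ z)

data Orbit {n : ℕ} (a b : Fin n → ℤ) (s : ℤ) : ℤ → Set where
  base : Orbit a b s s
  step : ∀ (i : Fin n) {y : ℤ} → Orbit a b s y → Orbit a b s (aff a b i y)

-- "|S ∩ [0,x]| ≥ length L" witnessed by a duplicate-free list L of
-- elements of S ∩ [0,x].
AtLeastInRange : (ℤ → Set) → ℕ → List ℤ → Set
AtLeastInRange S x L = Unique L × All (λ y → S y × (+0 ≤ℤ y) × (y ≤ℤ + x)) L

-- Positive lower asymptotic density: liminf_{x→∞} |S ∩ [0,x]| / x > 0,
-- i.e. there are c ≥ 1 and X with |S ∩ [0,x]| ≥ x / c for all x ≥ X.
PositiveLowerDensity : (ℤ → Set) → Set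
PositiveLowerDensity S =
  Σ ℕ λ c → (1 ≤ c) × Σ ℕ λ X → ∀ (x : ℕ) → X ≤ x →
    Σ (List ℤ) λ L → AtLeastInRange S x L × (x ≤ c * length L)

-- Write f_k(t) = A_k t + B_k on ℕ and let T bound all B_k. Since the f_k(ℤ) partition ℤ, every
-- z > T is f_k(p) for a unique k and some 1 ≤ p < z; unwinding this recursively writes z as a word
-- in the maps applied to a base value y ≤ T. Applying the same word to f_i(f_j^y(s)), where i ≠ j
-- and s is a positive orbit point, gives an orbit point ψ(z). Disjointness of the images makes ψ
-- injective, and ψ(z) ≤ K z with K = f_i(f_j^T(s)) because f_k(K p) ≤ K f_k(p). Hence
-- ψ(1), …, ψ(⌊X/K⌋) are distinct orbit points in [0, X], at least X / 2K of them.
module Submission where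

module Natural where

  open import Data.Nat using (ℕ; zero; suc; _+_; _*_; _⊔_; _≤_; _<_; _<′_; ≤′-refl; ≤′-step; z≤n; s≤s; NonZero; >-nonZero)
  open import Data.Nat.Properties
  open import Data.Nat.Induction using (<-rec)
  open import Data.Nat.DivMod using (_/_; _%_; m≡m%n+[m/n]*n; m%n<n; m/n*n≤m; m≥n⇒m/n>0)
  open import Data.Nat.Tactic.RingSolver using (solve-∀)
  open import Data.Fin using (Fin; zero; suc)
  open import Data.List using (List; applyUpTo; length)
  open import Data.List.Properties using (length-applyUpTo)
  open import Data.List.Relation.Unary.All using (All)
  open import Data.List.Relation.Unary.All.Properties using (applyUpTo⁺₁)
  open import Data.List.Relation.Unary.Unique.Propositional using (Unique)
  import Data.List.Relation.Unary.Unique.Propositional.Properties as Unique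
  open import Data.Product using (Σ; ∃; ∃₂; _×_; _,_; -,_; proj₁; proj₂)
  open import Data.Sum using (inj₁; inj₂)
  open import Data.Empty using (⊥-elim)
  open import Function using (_∘_)
  open import Relation.Nullary using (yes; no)
  open import Relation.Binary.Definitions using (tri<; tri≈; tri>)
  open import Relation.Binary.PropositionalEquality

  upper-bound : ∀ {n} (f : Fin n → ℕ) → ∃ λ T → ∀ k → f k ≤ T
  upper-bound {zero} f = 0 , λ ()
  upper-bound {suc n} f with upper-bound (f ∘ suc)
  ... | T , f∘suc≤T = f zero ⊔ T , λ { zero → m≤m⊔n (f zero) T
                                     ; (suc k) → ≤-trans (f∘suc≤T k) (m≤n⊔m (f zero) T) }

  DenseSample : (ℕ → Set) → ℕ → ℕ → Set
  DenseSample P c X = Σ (List ℕ) λ L → Unique L × All (λ o → P o × o ≤ X) L × X ≤ c * length L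

  injection⇒DenseSample : (P : ℕ → Set) (K : ℕ) .{{_ : NonZero K}} (ψ : ℕ → ℕ)
    → (∀ {z z'} → ψ z ≡ ψ z' → z ≡ z') → (∀ z → P (ψ z)) → (∀ z → ψ z ≤ K * suc z)
    → ∀ X → K ≤ X → DenseSample P (2 * K) X
  injection⇒DenseSample P K ψ ψ-injective Pψ ψ≤ X K≤X =
    applyUpTo ψ m , unique , applyUpTo⁺₁ ψ m (λ {z} z<m → Pψ z , ψ≤X z<m) , X≤2Km
    where
    m : ℕ
    m = X / K

    unique : Unique (applyUpTo ψ m)
    unique = Unique.applyUpTo⁺₁ ψ m (λ z<z' _ → <⇒≢ z<z' ∘ ψ-injective)

    ψ≤X : ∀ {z} → z < m → ψ z ≤ X
    ψ≤X {z} z<m = begin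
      ψ z       ≤⟨ ψ≤ z ⟩
      K * suc z ≤⟨ *-monoʳ-≤ K z<m ⟩
      K * m     ≡⟨ *-comm K m ⟩
      m * K     ≤⟨ m/n*n≤m X K ⟩
      X         ∎
      where open ≤-Reasoning

    double : ∀ m K → m * K + m * K ≡ 2 * K * m
    double = solve-∀

    X≤2Km : X ≤ 2 * K * length (applyUpTo ψ m)
    X≤2Km rewrite length-applyUpTo ψ m = begin
      X             ≡⟨ m≡m%n+[m/n]*n X K ⟩
      X % K + m * K ≤⟨ +-monoˡ-≤ (m * K) (<⇒≤ (m%n<n X K)) ⟩
      K + m * K     ≤⟨ +-monoˡ-≤ (m * K) (m≤n*m K m {{>-nonZero (m≥n⇒m/n>0 K≤X)}}) ⟩
      m * K + m * K ≡⟨ double m K ⟩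
      2 * K * m     ∎
      where open ≤-Reasoning

  module AffineSystem {n : ℕ} (A B : Fin n → ℕ) (2≤A : ∀ k → 2 ≤ A k) where

    φ : Fin n → ℕ → ℕ
    φ k t = A k * t + B k

    φ-expanding : ∀ k {t} → 1 ≤ t → t < φ k t
    φ-expanding k {t} 1≤t = begin-strict
      t         <⟨ m<m*n t (A k) {{>-nonZero 1≤t}} (2≤A k) ⟩
      t * A k   ≡⟨ *-comm t (A k) ⟩
      A k * t   ≤⟨ m≤m+n (A k * t) (B k) ⟩
      φ k t     ∎
      where open ≤-Reasoning

    φ-monoʳ-≤ : ∀ k {t t'} → t ≤ t' → φ k t ≤ φ k t'
    φ-monoʳ-≤ k t≤t' = +-monoˡ-≤ (B k) (*-monoʳ-≤ (A k) t≤t')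

    φ-injective : ∀ k {t t'} → φ k t ≡ φ k t' → t ≡ t'
    φ-injective k {t} {t'} eq =
      *-cancelˡ-≡ t t' (A k) {{>-nonZero (≤-trans (s≤s z≤n) (2≤A k))}} (+-cancelʳ-≡ (B k) _ _ eq)

    φ-scale : ∀ k c t .{{_ : NonZero c}} → φ k (c * t) ≤ c * φ k t
    φ-scale k c t = begin
      A k * (c * t) + B k     ≤⟨ +-monoʳ-≤ (A k * (c * t)) (m≤n*m (B k) c) ⟩
      A k * (c * t) + c * B k ≡⟨ cong (_+ c * B k) (x*[y*z]≡y*[x*z] (A k) c t) ⟩
      c * (A k * t) + c * B k ≡⟨ *-distribˡ-+ c (A k * t) (B k) ⟨
      c * φ k t               ∎
      where
      open ≤-Reasoning
      x*[y*z]≡y*[x*z] : ∀ x y z → x * (y * z) ≡ y * (x * z)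
      x*[y*z]≡y*[x*z] = solve-∀

    module Coding
      (index-unique : ∀ k k' {x y} → φ k x ≡ φ k' y → k ≡ k')
      (T : ℕ) (covers-above : ∀ z → T < z → ∃₂ λ k p → 1 ≤ p × φ k p ≡ z)
      {i j : Fin n} (i≢j : i ≢ j) {s : ℕ} (1≤s : 1 ≤ s)
      where

      chain : ℕ → ℕ
      chain zero    = s
      chain (suc m) = φ j (chain m)

      1≤chain : ∀ m → 1 ≤ chain m
      1≤chain zero    = 1≤s
      1≤chain (suc m) = ≤-trans (1≤chain m) (<⇒≤ (φ-expanding j (1≤chain m)))

      chain-<′ : ∀ {m m'} → m <′ m' → chain m < chain m'
      chain-<′ {m} ≤′-refl                  = φ-expanding j (1≤chain m)
      chain-<′ {m' = suc m'} (≤′-step m<′m') = <-trans (chain-<′ m<′m') (φ-expanding j (1≤chain m'))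

      chain-mono-≤ : ∀ {m m'} → m ≤ m' → chain m ≤ chain m'
      chain-mono-≤ m≤m' with m≤n⇒m<n∨m≡n m≤m'
      ... | inj₁ m<m' = <⇒≤ (chain-<′ (<⇒<′ m<m'))
      ... | inj₂ refl = ≤-refl

      chain-injective : ∀ {m m'} → chain m ≡ chain m' → m ≡ m'
      chain-injective {m} {m'} eq with <-cmp m m'
      ... | tri< m<m' _ _ = ⊥-elim (<⇒≢ (chain-<′ (<⇒<′ m<m')) eq)
      ... | tri≈ _ m≡m' _ = m≡m'
      ... | tri> _ _ m'<m = ⊥-elim (<⇒≢ (chain-<′ (<⇒<′ m'<m)) (sym eq))

      -- Code z o says that o = ψ(z).
      data Code : ℕ → ℕ → Set where
        small : ∀ {y} → y ≤ T → Code y (φ i (chain y))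
        large : ∀ {p o} k → 1 ≤ p → Code p o → Code (φ k p) (φ k o)

      code-exists : ∀ z → ∃ (Code z)
      code-exists = <-rec (λ z → ∃ (Code z)) code
        where
        code : ∀ z → (∀ {p} → p < z → ∃ (Code p)) → ∃ (Code z)
        code z rec with z ≤? T
        ... | yes z≤T = -, small z≤T
        ... | no z≰T with covers-above z (≰⇒> z≰T)
        ... | k , p , 1≤p , refl = -, large k 1≤p (proj₂ (rec (φ-expanding k 1≤p)))

      s<code : ∀ {z o} → Code z o → s < o
      s<code (small {y} _) = ≤-<-trans (chain-mono-≤ {0} {y} z≤n) (φ-expanding i (1≤chain y))
      s<code (large k _ c) = <-trans (s<code c) (φ-expanding k (≤-trans 1≤s (<⇒≤ (s<code c))))

      code≢chain : ∀ {z o} → Code z o → ∀ m → o ≢ chain m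
      code≢chain c             zero    o≡s = <⇒≢ (s<code c) (sym o≡s)
      code≢chain (small _)     (suc m) eq  = i≢j (index-unique i j eq)
      code≢chain (large k _ c) (suc m) eq  with index-unique k j eq
      ... | refl = code≢chain c m (φ-injective k eq)

      code-injective : ∀ {z z' o o'} → Code z o → Code z' o' → o ≡ o' → z ≡ z'
      code-injective (small _) (small _) eq = chain-injective (φ-injective i eq)
      code-injective (small {y} _) (large k _ c) eq with index-unique i k eq
      ... | refl = ⊥-elim (code≢chain c y (sym (φ-injective i eq)))
      code-injective (large k _ c) (small {y} _) eq with index-unique k i eq
      ... | refl = ⊥-elim (code≢chain c y (φ-injective k eq))
      code-injective (large k _ c) (large k' _ c') eq with index-unique k k' eq
      ... | refl = cong (φ k) (code-injective c c' (φ-injective k eq))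

      K : ℕ
      K = φ i (chain T)

      1≤K : 1 ≤ K
      1≤K = ≤-trans 1≤s (<⇒≤ (s<code (small {T} ≤-refl)))

      instance
        K-nonZero : NonZero K
        K-nonZero = >-nonZero 1≤K

      code≤K* : ∀ {z o} → Code z o → 1 ≤ z → o ≤ K * z
      code≤K* (small {y} y≤T) 1≤y = begin
        φ i (chain y) ≤⟨ φ-monoʳ-≤ i (chain-mono-≤ y≤T) ⟩
        K             ≤⟨ m≤m*n K y {{>-nonZero 1≤y}} ⟩
        K * y         ∎
        where open ≤-Reasoning
      code≤K* (large {p} {o} k 1≤p c) _ = begin
        φ k o         ≤⟨ φ-monoʳ-≤ k (code≤K* c 1≤p) ⟩
        φ k (K * p)   ≤⟨ φ-scale k K p ⟩
        K * φ k p     ∎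
        where open ≤-Reasoning

      module _ (P : ℕ → Set) (Ps : P s) (P-closed : ∀ k {t} → P t → P (φ k t)) where

        chain∈ : ∀ m → P (chain m)
        chain∈ zero    = Ps
        chain∈ (suc m) = P-closed j (chain∈ m)

        code∈ : ∀ {z o} → Code z o → P o
        code∈ (small {y} _)  = P-closed i (chain∈ y)
        code∈ (large k _ c)  = P-closed k (code∈ c)

        closed⇒DenseSample : ∀ X → K ≤ X → DenseSample P (2 * K) X
        closed⇒DenseSample =
          injection⇒DenseSample P K ψ⁺ ψ⁺-injective (code∈ ∘ ψ⁺-code) (λ z → code≤K* (ψ⁺-code z) (s≤s z≤n))
          where
          ψ⁺ : ℕ → ℕ
          ψ⁺ z = proj₁ (code-exists (suc z))

          ψ⁺-code : ∀ z → Code (suc z) (ψ⁺ z)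
          ψ⁺-code z = proj₂ (code-exists (suc z))

          ψ⁺-injective : ∀ {z z'} → ψ⁺ z ≡ ψ⁺ z' → z ≡ z'
          ψ⁺-injective eq = suc-injective (code-injective (ψ⁺-code _) (ψ⁺-code _) eq)

open import Defs
open import Data.Nat using (ℕ; zero; suc)
open import Data.Integer using (ℤ; +0; 1ℤ; _≤_; _<_)
open import Data.Fin using (Fin)

open Natural using (DenseSample; upper-bound; module AffineSystem)
import Data.Nat as ℕ
import Data.Nat.Properties as ℕₚ
import Data.Integer as ℤ
import Data.Integer.Properties as ℤₚ
open import Data.Integer using (+_; +[1+_]; -[1+_]; ∣_∣; +≤+; +<+; -≤+)
open import Data.Fin using (zero; suc)
open import Data.Fin.Properties using () renaming (_≟_ to _≟ᶠ_)
open import Data.List using (List; map; length)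
open import Data.List.Properties using (length-map)
import Data.List.Relation.Unary.All as All
import Data.List.Relation.Unary.All.Properties as All
import Data.List.Relation.Unary.Unique.Propositional.Properties as Unique
open import Data.Product using (Σ; ∃₂; _×_; _,_)
open import Data.Empty using (⊥-elim)
open import Function using (_∘_)
open import Relation.Nullary using (yes; no)
open import Relation.Binary.PropositionalEquality
open import Algebra.Properties.AbelianGroup ℤₚ.+-0-abelianGroup using (∙-cancelʳ)

1<i⇒i*j≢1 : ∀ {i} j → 1ℤ < i → i ℤ.* j ≢ 1ℤ
1<i⇒i*j≢1 {+ m} j (+<+ 1<m) i*j≡1 =
  ℕₚ.<⇒≢ 1<m (sym (ℕₚ.m*n≡1⇒m≡1 m ∣ j ∣ (trans (sym (ℤₚ.abs-* (+ m) j)) (cong ∣_∣ i*j≡1))))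

DenseSamples⇒PositiveLowerDensity : ∀ {S : ℤ → Set} c X → 1 ℕ.≤ c
  → (∀ x → X ℕ.≤ x → DenseSample (S ∘ +_) c x) → PositiveLowerDensity S
DenseSamples⇒PositiveLowerDensity c X 1≤c samples = c , 1≤c , X , λ x X≤x → sample x (samples x X≤x)
  where
  sample : ∀ {S} x → DenseSample (S ∘ +_) c x → Σ (List ℤ) λ L → AtLeastInRange S x L × x ℕ.≤ c ℕ.* length L
  sample x (L , unique , bounded , x≤cL) =
    map +_ L ,
    (Unique.map⁺ ℤₚ.+-injective unique , All.map⁺ (All.map (λ (o∈S , o≤x) → o∈S , +≤+ ℕ.z≤n , +≤+ o≤x) bounded)) ,
    subst (λ l → x ℕ.≤ c ℕ.* l) (sym (length-map +_ L)) x≤cL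

Covering : ∀ {n} → (Fin n → ℤ) → (Fin n → ℤ) → Set
Covering {n} a b = ∀ z → Σ (Fin n) λ k → Σ ℤ λ x → aff a b k x ≡ z

distinct-indices : ∀ {n} {a b : Fin n → ℤ} → (∀ k → 1ℤ < a k) → Covering a b
  → Σ (Fin n) λ i → Σ (Fin n) λ j → i ≢ j
distinct-indices {0} _ cover with cover +0
... | () , _
distinct-indices {1} {a} {b} 1<a cover with cover (1ℤ ℤ.+ b zero)
... | zero , x , eq = ⊥-elim (1<i⇒i*j≢1 x (1<a zero) (∙-cancelʳ (b zero) (a zero ℤ.* x) 1ℤ eq))
distinct-indices {suc (suc _)} _ _ = zero , suc zero , λ ()

module IntegerSystem {n : ℕ} {a b : Fin n → ℤ} (1<a : ∀ k → 1ℤ < a k) (0≤b : ∀ k → +0 ≤ b k) where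

  A B : Fin n → ℕ
  A k = ∣ a k ∣
  B k = ∣ b k ∣

  +A≡a : ∀ k → + A k ≡ a k
  +A≡a k = ℤₚ.0≤i⇒+∣i∣≡i (ℤₚ.≤-trans (+≤+ ℕ.z≤n) (ℤₚ.<⇒≤ (1<a k)))

  +B≡b : ∀ k → + B k ≡ b k
  +B≡b k = ℤₚ.0≤i⇒+∣i∣≡i (0≤b k)

  2≤A : ∀ k → 2 ℕ.≤ A k
  2≤A k = ℤₚ.drop‿+<+ (subst (1ℤ <_) (sym (+A≡a k)) (1<a k))

  open AffineSystem A B 2≤A public

  aff-+ : ∀ k t → aff a b k (+ t) ≡ + φ k t
  aff-+ k t = begin
    a k ℤ.* + t ℤ.+ b k     ≡⟨ cong₂ (λ u v → u ℤ.* + t ℤ.+ v) (+A≡a k) (+B≡b k) ⟨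
    + A k ℤ.* + t ℤ.+ + B k ≡⟨ cong (ℤ._+ + B k) (ℤₚ.pos-* (A k) t) ⟨
    + φ k t                 ∎
    where open ≡-Reasoning

  nonpositive-preimage : ∀ k {x z} → x ≤ +0 → aff a b k x ≡ + z → z ℕ.≤ B k
  nonpositive-preimage k {x} {z} x≤0 eq = ℤₚ.drop‿+≤+ (begin
    + z                    ≡⟨ eq ⟨
    a k ℤ.* x ℤ.+ b k      ≡⟨ cong (λ u → u ℤ.* x ℤ.+ b k) (+A≡a k) ⟨
    + A k ℤ.* x ℤ.+ b k    ≤⟨ ℤₚ.+-monoˡ-≤ (b k) (ℤₚ.*-monoˡ-≤-nonNeg (+ A k) x≤0) ⟩
    + A k ℤ.* +0 ℤ.+ b k   ≡⟨ cong (ℤ._+ b k) (ℤₚ.*-zeroʳ (+ A k)) ⟩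
    +0 ℤ.+ b k             ≡⟨ ℤₚ.+-identityˡ (b k) ⟩
    b k                    ≡⟨ +B≡b k ⟨
    + B k                  ∎)
    where open ℤₚ.≤-Reasoning

  index-unique : (∀ (k k' : Fin n) (x y : ℤ) → k ≢ k' → aff a b k x ≢ aff a b k' y)
    → ∀ k k' {x y} → φ k x ≡ φ k' y → k ≡ k'
  index-unique disjoint k k' {x} {y} eq with k ≟ᶠ k'
  ... | yes k≡k' = k≡k'
  ... | no k≢k' =
    ⊥-elim (disjoint k k' (+ x) (+ y) k≢k' (trans (aff-+ k x) (trans (cong +_ eq) (sym (aff-+ k' y)))))

  orbit-closed : ∀ {s} k {o} → Orbit a b s (+ o) → Orbit a b s (+ φ k o)
  orbit-closed k {o} o∈orbit = subst (Orbit a b _) (aff-+ k o) (step k o∈orbit)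

  module _ (cover : Covering a b) where

    positive-preimage : ∀ z → (∀ k → B k ℕ.< z) → ∃₂ λ k p → 1 ℕ.≤ p × φ k p ≡ z
    positive-preimage z B<z with cover (+ z)
    ... | k , +[1+ p ] , eq = k , suc p , ℕ.s≤s ℕ.z≤n , ℤₚ.+-injective (trans (sym (aff-+ k (suc p))) eq)
    ... | k , +0       , eq = ⊥-elim (ℕₚ.<⇒≱ (B<z k) (nonpositive-preimage k ℤₚ.≤-refl eq))
    ... | k , -[1+ q ] , eq = ⊥-elim (ℕₚ.<⇒≱ (B<z k) (nonpositive-preimage k -≤+ eq))

    positive-orbit-point : ∀ s → +0 ≤ s → Σ ℕ λ t → 1 ℕ.≤ t × Orbit a b s (+ t)
    positive-orbit-point +[1+ m ] _ = suc m , ℕ.s≤s ℕ.z≤n , base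
    positive-orbit-point +0 _ with cover 1ℤ
    ... | k , x , eq = φ k 0 , ℕₚ.≤-trans 1≤B (ℕₚ.m≤n+m (B k) (A k ℕ.* 0)) , orbit-closed k base
      where
      b≢0 : b k ≢ +0
      b≢0 b≡0 = 1<i⇒i*j≢1 x (1<a k) (begin
        a k ℤ.* x          ≡⟨ ℤₚ.+-identityʳ (a k ℤ.* x) ⟨
        a k ℤ.* x ℤ.+ +0   ≡⟨ cong (λ β → a k ℤ.* x ℤ.+ β) b≡0 ⟨
        a k ℤ.* x ℤ.+ b k  ≡⟨ eq ⟩
        1ℤ                 ∎)
        where open ≡-Reasoning

      1≤B : 1 ℕ.≤ B k
      1≤B = ℕₚ.n≢0⇒n>0 (b≢0 ∘ ℤₚ.∣i∣≡0⇒i≡0)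

mainTheorem4 : ∀ (n : ℕ) (a b : Fin n → ℤ)
    → (∀ i → 1ℤ < a i)
    → (∀ i → +0 ≤ b i)
    → ExactCover a b
    → ∀ (s : ℤ) → +0 ≤ s
    → PositiveLowerDensity (Orbit a b s)
mainTheorem4 n a b 1<a 0≤b (disjoint , cover) s 0≤s
  with upper-bound (IntegerSystem.B 1<a 0≤b)
     | distinct-indices 1<a cover
     | IntegerSystem.positive-orbit-point 1<a 0≤b cover s 0≤s
... | T , B≤T | _ , _ , i≢j | t , 1≤t , t∈orbit =
  DenseSamples⇒PositiveLowerDensity (2 ℕ.* K) K (ℕₚ.≤-trans 1≤K (ℕₚ.m≤n*m K 2))
    (closed⇒DenseSample (Orbit a b s ∘ +_) t∈orbit orbit-closed)
  where
  open IntegerSystem 1<a 0≤b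

  covers-above : ∀ z → T ℕ.< z → ∃₂ λ k p → 1 ℕ.≤ p × φ k p ≡ z
  covers-above z T<z = positive-preimage cover z (λ k → ℕₚ.≤-<-trans (B≤T k) T<z)

  open Coding (index-unique disjoint) T covers-above i≢j 1≤t
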